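{- (1) Let $b\ge 1$ and $\tau\in\{\tau_{PT}^b,\tau_{PPT}^b\}$. Let $U=U(A_0,\dots,A_n)$ be a union of linear TS $A_i=(S_i,E_i,\delta_i,\iota_i)$ with terminal states $t_i$, such that for every event $e\in E(U)$ there is a state $s\in S(U)$ at which $e$ does not occur. Then $U$ has the $\tau$-ESSP if and only if $LJ(U)$ has the $\tau$-ESSP, and $U$ has the $\tau$-SSP if and only if $LJ(U)$ has the $\tau$-SSP. (2) Let $b\ge 2$ and $\tau\in\{\tau_{\mathbb{Z}PT}^b,\tau_{\mathbb{Z}PPT}^b\}$. Let $U=U(A_0,\dots,A_n)$ be a union of TS $A_i=(S_i,E_i,\delta_i,\iota_i)$ such that for every event $e\in E(U)$ there is a state $s\in S(U)$ at which $e$ does not occur. Then $U$ has the $\tau$-ESSP if and only if $J(U)$ has the $\tau$-ESSP, and $U$ has the $\tau$-SSP if and only if $J(U)$ has the $\tau$-SSP.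
   Context: A transition system (TS) is $A=(S,E,\delta,\iota)$ with finite $S,E$, partial $\delta:S\times E\to S$ and initial state $\iota$ from which all states are reachable; $e$ occurs at $s$ if $\delta(s,e)$ is defined. $A$ is linear if it is $s_0\xrightarrow{e_1}\cdots\xrightarrow{e_m}s_m$ with pairwise distinct states and no other edges; $s_m$ is its terminal state. Types of nets (TS $\tau=(S_\tau,E_\tau,\delta_\tau)$ without initial state): $\tau_{PT}^b$ has $S_\tau=\{0,\dots,b\}$, $E_\tau=\{0,\dots,b\}^2$, $\delta_\tau(s,(m,n))=s-m+n$ if $s\ge m$ and $s-m+n\le b$, else undefined; $\tau_{PPT}^b$ removes events $(m,n)$ with $1\le m,n\le b$; $\tau_{\mathbb{Z}PT}^b$ has $S_\tau=\{0,\dots,b\}$, $E_\tau=(\{0,\dots,b\}^2\setminus\{(0,0)\})\cup\{0,\dots,b\}$ (integers distinct from pairs), pairs acting as in $\tau_{PT}^b$ and $\delta_\tau(s,x)=(s+x)\bmod(b+1)$; $\tau_{\mathbb{Z}PPT}^b$ removes from it the events $(m,n)$ with $1\le m,n\le b$. For TS $A_0,\dots,A_n$ with pairwise disjoint state sets, the union $U=U(A_0,\dots,A_n)$ has $S(U)=\bigcup S_i$, $E(U)=\bigcup E_i$. A $\tau$-region of $U$ is $(sup,sig)$, $sup:S(U)\to S_\tau$, $sig:E(U)\to E_\tau$, with $\delta_\tau(sup(s),sig(e))=sup(s')$ for every edge $s\xrightarrow{e}s'$ of every $A_i$. An SSA of $U$ is a pair of distinct states of the same $A_i$, solved if $sup(s)\ne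 sup(s')$; an ESSA of $U$ is $(e,s)$ with $e\in E(U)$, $s\in S(U)$, $e$ not occurring at $s$, solved if $\delta_\tau(sup(s),sig(e))$ is undefined. $U$ (or a TS) has the $\tau$-SSP / $\tau$-ESSP if all its SSA / ESSA are solved by $\tau$-regions (for a TS, regions, SSA and ESSA are defined in the same way, SSA being all pairs of distinct states). Linear joining: with fresh states $q_1,\dots,q_n$ and fresh events $w_1,\dots,w_n,y_1,\dots,y_n$, $LJ(U)$ is the TS with states $S(U)\cup\{q_1,\dots,q_n\}$, events $E(U)\cup\{w_i\}\cup\{y_i\}$, initial state $\iota_0$, all edges of the $A_i$, plus $t_i\xrightarrow{w_{i+1}}q_{i+1}$ ($0\le i\le n-1$) and $q_i\xrightarrow{y_i}\iota_i$ ($1\le i\le n$). Joining: with fresh states $q_0,\dots,q_n$ and fresh events $w_1,\dots,w_n,y_0,\dots,y_n$, $J(U)$ has states $S(U)\cup\{q_0,\dots,q_n\}$, events $E(U)\cup\{w_i\}\cup\{y_i\}$, initial state $q_0$, all edges of the $A_i$, plus $q_i\xrightarrow{w_{i+1}}q_{i+1}$ ($0\le i\le n-1$) and $q_i\xrightarrow{y_i}\iota_i$ ($0\le i\le n$). -}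

module Defs where

open import Data.Nat using (ℕ; zero; suc; _+_; _∸_; _≤_; _<_; _≤?_; _<?_)
open import Data.Nat.DivMod using (_%_; m%n<n)
open import Data.Fin using (Fin; zero; suc; toℕ; fromℕ<; fromℕ; inject₁; _≟_)
open import Data.Vec using (Vec; []; _∷_)
open import Data.Maybe using (Maybe; just; nothing)
import Data.Maybe as Maybe
open import Data.Product using (Σ; _×_; _,_; proj₁; proj₂)
open import Data.Sum using (_⊎_; inj₁; inj₂)
open import Relation.Nullary using (¬_; yes; no)
open import Relation.Binary.PropositionalEquality using (_≡_; _≢_; refl; cong)

-- Transition systems.  The event set is Fin m (shared by all
-- components of a union), the state set of a TS is Fin size.

data Reachable {S E : Set} (δ : S → E → Maybe S) (ι : S) : S → Set where
  here : Reachable δ ι ι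
  step : ∀ {s s'} (e : E) → Reachable δ ι s → δ s e ≡ just s' → Reachable δ ι s'

record TS (m : ℕ) : Set where
  field
    size  : ℕ
    δ     : Fin size → Fin m → Maybe (Fin size)
    ι     : Fin size
    reach : ∀ s → Reachable δ ι s

open TS public

-- Linear TS  s_0 -e_1-> s_1 ... -e_l-> s_l  given by its event word.

linδ : ∀ {m l} → Vec (Fin m) l → Fin (suc l) → Fin m → Maybe (Fin (suc l))
linδ []      zero    e = nothing
linδ (x ∷ w) zero    e with x ≟ e
... | yes _ = just (suc zero)
... | no  _ = nothing
linδ (x ∷ w) (suc s) e = Maybe.map suc (linδ w s e)

private
  lift-reach : ∀ {m l} (x : Fin m) (w : Vec (Fin m) l) {s} →
               Reachable (linδ w) zero s →
               Reachable (linδ (x ∷ w)) (suc zero) (suc s)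
  lift-reach x w here = here
  lift-reach x w (step e r eq) = step e (lift-reach x w r) (cong (Maybe.map suc) eq)

  first-step : ∀ {m l} (x : Fin m) (w : Vec (Fin m) l) →
               linδ (x ∷ w) zero x ≡ just (suc zero)
  first-step x w with x ≟ x
  ... | yes _ = refl
  ... | no ¬p = Data.Empty.⊥-elim (¬p refl)
    where import Data.Empty

  lin-reach : ∀ {m l} (w : Vec (Fin m) l) (s : Fin (suc l)) → Reachable (linδ w) zero s
  lin-reach w zero = here
  lin-reach (x ∷ w) (suc s) =
    go (lift-reach x w (lin-reach w s))
    where
      go : ∀ {t} → Reachable (linδ (x ∷ w)) (suc zero) t → Reachable (linδ (x ∷ w)) zero t
      go here = step x here (first-step x w)
      go (step e r eq) = step e (go r) eq

linTS : ∀ {m l} → Vec (Fin m) l → TS m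
linTS {l = l} w = record { size = suc l ; δ = linδ w ; ι = zero ; reach = lin-reach w }

terminal : (l : ℕ) → Fin (suc l)
terminal l = fromℕ l

record Ty : Set₁ where
  field
    St : Set
    Ev : Set
    δτ : St → Ev → Maybe St

open Ty public

pairAct : (b : ℕ) → Fin (suc b) → Fin (suc b) × Fin (suc b) → Maybe (Fin (suc b))
pairAct b s (m , n) with toℕ m ≤? toℕ s | toℕ s ∸ toℕ m + toℕ n <? suc b
... | yes _ | yes p = just (fromℕ< p)
... | _     | _     = nothing

modAct : (b : ℕ) → Fin (suc b) → Fin (suc b) → Maybe (Fin (suc b))
modAct b s x = just (fromℕ< (m%n<n (toℕ s + toℕ x) (suc b)))

Pair : ℕ → Set
Pair b = Fin (suc b) × Fin (suc b)

IsPure : ∀ {b} → Pair b → Set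
IsPure p = proj₁ p ≡ zero ⊎ proj₂ p ≡ zero

IsZeroPair : ∀ {b} → Pair b → Set
IsZeroPair p = proj₁ p ≡ zero × proj₂ p ≡ zero

τPT : ℕ → Ty
τPT b = record { St = Fin (suc b) ; Ev = Pair b ; δτ = pairAct b }

τPPT : ℕ → Ty
τPPT b = record { St = Fin (suc b) ; Ev = Σ (Pair b) IsPure
                ; δτ = λ s e → pairAct b s (proj₁ e) }

zAct : (b : ℕ) {P : Pair b → Set} → Fin (suc b) → Σ (Pair b) P ⊎ Fin (suc b) → Maybe (Fin (suc b))
zAct b s (inj₁ p) = pairAct b s (proj₁ p)
zAct b s (inj₂ x) = modAct b s x

τZPT : ℕ → Ty
τZPT b = record { St = Fin (suc b)
                ; Ev = Σ (Pair b) (λ p → ¬ IsZeroPair p) ⊎ Fin (suc b)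
                ; δτ = zAct b }

τZPPT : ℕ → Ty
τZPPT b = record { St = Fin (suc b)
                 ; Ev = Σ (Pair b) (λ p → IsPure p × ¬ IsZeroPair p) ⊎ Fin (suc b)
                 ; δτ = zAct b }

record Region (τ : Ty) {S E : Set} (δ : S → E → Maybe S) : Set where
  field
    sup : S → St τ
    sig : E → Ev τ
    hom : ∀ s e s' → δ s e ≡ just s' → δτ τ (sup s) (sig e) ≡ just (sup s')

open Region public

ESSP : (τ : Ty) {S E : Set} (δ : S → E → Maybe S) → Set
ESSP τ {S} {E} δ = ∀ (e : E) (s : S) → δ s e ≡ nothing →
  Σ (Region τ δ) λ R → δτ τ (sup R s) (sig R e) ≡ nothing

SSP : (τ : Ty) {S E : Set} (δ : S → E → Maybe S) → Set
SSP τ {S} δ = ∀ (s s' : S) → s ≢ s' → Σ (Region τ δ) λ R → sup R s ≢ sup R s'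

USt : ∀ {m n} → (Fin (suc n) → TS m) → Set
USt {n = n} A = Σ (Fin (suc n)) λ i → Fin (size (A i))

Uδ : ∀ {m n} (A : Fin (suc n) → TS m) → USt A → Fin m → Maybe (USt A)
Uδ A (i , s) e = Maybe.map (λ s' → (i , s')) (δ (A i) s e)

UESSP : (τ : Ty) → ∀ {m n} → (Fin (suc n) → TS m) → Set
UESSP τ A = ESSP τ (Uδ A)

USSP : (τ : Ty) → ∀ {m n} → (Fin (suc n) → TS m) → Set
USSP τ {n = n} A = ∀ (i : Fin (suc n)) (s s' : Fin (size (A i))) → s ≢ s' →
  Σ (Region τ (Uδ A)) λ R → sup R (i , s) ≢ sup R (i , s')

EveryEventDisabled : ∀ {m n} → (Fin (suc n) → TS m) → Set
EveryEventDisabled {m} A = ∀ (e : Fin m) → Σ (USt A) λ s → Uδ A s e ≡ nothing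

-- States: inj₁ u (states of U), inj₂ j  = q_{j+1}  (j : Fin n).
-- Events: inj₁ e (events of U), inj₂ (inj₁ j) = w_{j+1}, inj₂ (inj₂ j) = y_{j+1}.
-- Initial state ι_0 (irrelevant for SSP/ESSP).

LJSt : ∀ {m n} → (Fin (suc n) → TS m) → Set
LJSt {n = n} A = USt A ⊎ Fin n

LJEv : ℕ → ℕ → Set
LJEv m n = Fin m ⊎ (Fin n ⊎ Fin n)

LJδ : ∀ {m n} (A : Fin (suc n) → TS m) (t : (i : Fin (suc n)) → Fin (size (A i))) →
      LJSt A → LJEv m n → Maybe (LJSt A)
LJδ A t (inj₁ u) (inj₁ e) = Maybe.map inj₁ (Uδ A u e)
-- t_i -w_{i+1}-> q_{i+1}
LJδ A t (inj₁ (i , s)) (inj₂ (inj₁ j)) with i ≟ inject₁ j | s ≟ t i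
... | yes _ | yes _ = just (inj₂ j)
... | _     | _     = nothing
LJδ A t (inj₁ u) (inj₂ (inj₂ k)) = nothing
LJδ A t (inj₂ j) (inj₁ e) = nothing
LJδ A t (inj₂ j) (inj₂ (inj₁ k)) = nothing
-- q_{j+1} -y_{j+1}-> ι_{j+1}
LJδ A t (inj₂ j) (inj₂ (inj₂ k)) with j ≟ k
... | yes _ = just (inj₁ (suc j , ι (A (suc j))))
... | no  _ = nothing

-- States: inj₁ u (states of U), inj₂ i = q_i (i : Fin (suc n)).
-- Events: inj₁ e, inj₂ (inj₁ j) = w_{j+1} (j : Fin n), inj₂ (inj₂ i) = y_i (i : Fin (suc n)).
-- Initial state q_0 (irrelevant for SSP/ESSP).

JSt : ∀ {m n} → (Fin (suc n) → TS m) → Set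
JSt {n = n} A = USt A ⊎ Fin (suc n)

JEv : ℕ → ℕ → Set
JEv m n = Fin m ⊎ (Fin n ⊎ Fin (suc n))

Jδ : ∀ {m n} (A : Fin (suc n) → TS m) → JSt A → JEv m n → Maybe (JSt A)
Jδ A (inj₁ u) (inj₁ e) = Maybe.map inj₁ (Uδ A u e)
Jδ A (inj₁ u) (inj₂ _) = nothing
Jδ A (inj₂ i) (inj₁ e) = nothing
-- q_i -w_{i+1}-> q_{i+1}
Jδ A (inj₂ i) (inj₂ (inj₁ j)) with i ≟ inject₁ j
... | yes _ = just (inj₂ (suc j))
... | no  _ = nothing
-- q_i -y_i-> ι_i
Jδ A (inj₂ i) (inj₂ (inj₂ k)) with i ≟ k
... | yes _ = just (inj₁ (i , ι (A i)))
... | no  _ = nothing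

module Submission where

-- Regions restrict from J(U) and LJ(U) to U, and conversely extend: give the fresh states any
-- values and sign each fresh event, which labels a single edge, by an event moving the value
-- of its source to that of its target. An ESSA (e, q) with e old and q fresh is solved by
-- extending a region of U that solves (e, s) for some s, with q given the value of s. States of
-- different blocks (components of U, fresh states) are separated by the indicator of a block;
-- the indicator of the source block of a fresh event x solves (x, p) for p outside that block,
-- since x then moves 1 to 0 and is disabled at 0. What remains is (w_{j+1}, s) in LJ(U) with s
-- a non-terminal state of the linear A_j: a region of U separates the live s from the dead t_j,
-- and the type has an event enabled at the value of t_j but disabled at that of s.

open import Defs
open import Data.Nat using (ℕ; zero; suc; _+_; _∸_; _≤_; _<_; _≤?_; _<?_; z≤n; s≤s)
open import Data.Nat.Properties
  using (module ≤-Reasoning; ≤-refl; ≤-trans; ≤-pred; <⇒≤; <⇒≱; ≰⇒>; m∸n≤m; n∸n≡0; m+[n∸m]≡n; m∸[m∸n]≡n; +-identityʳ; +-monoˡ-<; 1+n≢n)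
open import Data.Nat.DivMod using (_%_; m%n<n; m<n⇒m%n≡m)
open import Data.Fin using (Fin; zero; suc; toℕ; fromℕ; fromℕ<; inject₁; _≟_)
open import Data.Fin.Properties
  using (toℕ-injective; toℕ<n; toℕ≤pred[n]; toℕ-fromℕ; toℕ-fromℕ<; toℕ-inject₁; <-cmp)
open import Data.Vec using (Vec; []; _∷_)
open import Data.Maybe using (Maybe; just; nothing)
import Data.Maybe as Maybe
open import Data.Maybe.Properties using (map-injective)
open import Data.Product using (Σ; _×_; _,_; proj₁; proj₂)
open import Data.Sum using (_⊎_; inj₁; inj₂; [_,_])
open import Data.Sum.Properties using (inj₁-injective; inj₂-injective; ≡-dec)
open import Function using (_∘_)
open import Function.Bundles using (_⇔_; mk⇔)
open import Relation.Nullary using (¬_; yes; no; contradiction)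
open import Relation.Binary.Definitions using (DecidableEquality; tri<; tri≈; tri>)
open import Relation.Binary.PropositionalEquality
  using (_≡_; _≢_; refl; sym; trans; cong; subst; ≡-≟-identity)

module PairActions (b : ℕ) where

  pairAct-just : ∀ {s m n c} → toℕ m ≤ toℕ s → toℕ s ∸ toℕ m + toℕ n ≡ toℕ c →
                 pairAct b s (m , n) ≡ just c
  pairAct-just {s} {m} {n} {c} m≤s eq with toℕ m ≤? toℕ s | toℕ s ∸ toℕ m + toℕ n <? suc b
  ... | yes _   | yes r  = cong just (toℕ-injective (trans (toℕ-fromℕ< r) eq))
  ... | no m≰s  | _      = contradiction m≤s m≰s
  ... | yes _   | no r≮  = contradiction (subst (_< suc b) (sym eq) (toℕ<n c)) r≮

  pairAct-just⁻¹ : ∀ {s m n c} → pairAct b s (m , n) ≡ just c →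
                   toℕ c ≡ toℕ s ∸ toℕ m + toℕ n
  pairAct-just⁻¹ {s} {m} {n} eq with toℕ m ≤? toℕ s | toℕ s ∸ toℕ m + toℕ n <? suc b
  pairAct-just⁻¹ refl | yes _ | yes r = toℕ-fromℕ< r
  pairAct-just⁻¹ ()   | yes _ | no _
  pairAct-just⁻¹ ()   | no _  | _

  pairAct-underflow : ∀ {s m n} → toℕ s < toℕ m → pairAct b s (m , n) ≡ nothing
  pairAct-underflow {s} {m} {n} s<m with toℕ m ≤? toℕ s | toℕ s ∸ toℕ m + toℕ n <? suc b
  ... | yes m≤s | yes _ = contradiction m≤s (<⇒≱ s<m)
  ... | yes _   | no _  = refl
  ... | no _    | _     = refl

  pairAct-overflow : ∀ {s m n} → b < toℕ s ∸ toℕ m + toℕ n → pairAct b s (m , n) ≡ nothing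
  pairAct-overflow {s} {m} {n} b<r with toℕ m ≤? toℕ s | toℕ s ∸ toℕ m + toℕ n <? suc b
  ... | yes _ | yes r<  = contradiction (≤-pred r<) (<⇒≱ b<r)
  ... | yes _ | no _    = refl
  ... | no _  | _       = refl

  zeroPair-fixes : ∀ {p a c} → IsZeroPair {b} p → pairAct b a p ≡ just c → a ≡ c
  zeroPair-fixes {a = a} (refl , refl) eq =
    sym (toℕ-injective (trans (pairAct-just⁻¹ eq) (+-identityʳ (toℕ a))))

  infixl 6 _⊖_

  _⊖_ : Fin (suc b) → Fin (suc b) → Fin (suc b)
  x ⊖ y = fromℕ< (s≤s (≤-trans (m∸n≤m (toℕ x) (toℕ y)) (toℕ≤pred[n] x)))

  toℕ-⊖ : ∀ x y → toℕ (x ⊖ y) ≡ toℕ x ∸ toℕ y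
  toℕ-⊖ x y = toℕ-fromℕ< (s≤s (≤-trans (m∸n≤m (toℕ x) (toℕ y)) (toℕ≤pred[n] x)))

  pureMove : Fin (suc b) → Fin (suc b) → Pair b
  pureMove a c with toℕ a ≤? toℕ c
  ... | yes _ = zero , c ⊖ a
  ... | no  _ = a ⊖ c , zero

  pureMove-pure : ∀ a c → IsPure (pureMove a c)
  pureMove-pure a c with toℕ a ≤? toℕ c
  ... | yes _ = inj₁ refl
  ... | no  _ = inj₂ refl

  pairAct-pureMove : ∀ a c → pairAct b a (pureMove a c) ≡ just c
  pairAct-pureMove a c with toℕ a ≤? toℕ c
  ... | yes a≤c = pairAct-just z≤n (trans (cong (toℕ a +_) (toℕ-⊖ c a)) (m+[n∸m]≡n a≤c))
  ... | no  a≰c = pairAct-just (subst (_≤ toℕ a) (sym (toℕ-⊖ a c)) (m∸n≤m (toℕ a) (toℕ c)))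
    (trans (+-identityʳ _) (trans (cong (toℕ a ∸_) (toℕ-⊖ a c)) (m∸[m∸n]≡n (<⇒≤ (≰⇒> a≰c)))))

  pureMove-nonzero : ∀ {a c} → a ≢ c → ¬ IsZeroPair (pureMove a c)
  pureMove-nonzero {a} {c} a≢c zp = a≢c (zeroPair-fixes zp (pairAct-pureMove a c))

  -- For v < a the pair (a, 0) underflows at v; for a < v the pair (0, b - a) overflows at v.
  separatingPair : ∀ {a v} → a ≢ v → Σ (Pair b) λ p → IsPure p ×
                   Σ (Fin (suc b)) λ c → pairAct b a p ≡ just c × pairAct b v p ≡ nothing
  separatingPair {a} {v} a≢v with <-cmp v a
  ... | tri< v<a _ _ = (a , zero) , inj₂ refl , zero ,
    pairAct-just ≤-refl (trans (+-identityʳ _) (n∸n≡0 (toℕ a))) , pairAct-underflow v<a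
  ... | tri≈ _ v≡a _ = contradiction (sym v≡a) a≢v
  ... | tri> _ _ a<v = (zero , fromℕ b ⊖ a) , inj₁ refl , fromℕ b ,
    pairAct-just z≤n a+[b∸a]≡b , pairAct-overflow b<v+[b∸a]
    where
    b∸a≡ : toℕ (fromℕ b ⊖ a) ≡ b ∸ toℕ a
    b∸a≡ = trans (toℕ-⊖ (fromℕ b) a) (cong (_∸ toℕ a) (toℕ-fromℕ b))
    a+[b∸a]≡b : toℕ a + toℕ (fromℕ b ⊖ a) ≡ toℕ (fromℕ b)
    a+[b∸a]≡b = trans (cong (toℕ a +_) b∸a≡)
                      (trans (m+[n∸m]≡n (toℕ≤pred[n] a)) (sym (toℕ-fromℕ b)))
    b<v+[b∸a] : b < toℕ v + toℕ (fromℕ b ⊖ a)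
    b<v+[b∸a] = begin-strict
      b                          ≡⟨ m+[n∸m]≡n (toℕ≤pred[n] a) ⟨
      toℕ a + (b ∸ toℕ a)        <⟨ +-monoˡ-< (b ∸ toℕ a) a<v ⟩
      toℕ v + (b ∸ toℕ a)        ≡⟨ cong (toℕ v +_) b∸a≡ ⟨
      toℕ v + toℕ (fromℕ b ⊖ a)  ∎
      where open ≤-Reasoning

  modAct-zero : ∀ a → modAct b a zero ≡ just a
  modAct-zero a = cong just (toℕ-injective
    (trans (toℕ-fromℕ< (m%n<n (toℕ a + 0) (suc b)))
           (trans (cong (_% suc b) (+-identityʳ (toℕ a))) (m<n⇒m%n≡m (toℕ<n a)))))

record Joinable (τ : Ty) : Set where
  field
    off on       : St τ
    on≢off       : on ≢ off
    idle         : Ev τ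
    idle-δ       : ∀ a → δτ τ a idle ≡ just a
    move         : St τ → St τ → Ev τ
    move-δ       : ∀ a c → δτ τ a (move a c) ≡ just c
    move-on-off-disabled : δτ τ off (move on off) ≡ nothing

SeparatesStates : Ty → Set
SeparatesStates τ = ∀ {a v} → a ≢ v →
  Σ (Ev τ) λ ev → Σ (St τ) λ c → δτ τ a ev ≡ just c × δτ τ v ev ≡ nothing

module _ (k : ℕ) where
  open PairActions (suc k)

  joinable-PT : Joinable (τPT (suc k))
  joinable-PT = record
    { off = zero ; on = suc zero ; on≢off = λ ()
    ; idle = zero , zero ; idle-δ = λ a → pairAct-just z≤n (+-identityʳ (toℕ a))
    ; move = pureMove ; move-δ = pairAct-pureMove ; move-on-off-disabled = refl }

  joinable-PPT : Joinable (τPPT (suc k))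
  joinable-PPT = record
    { off = zero ; on = suc zero ; on≢off = λ ()
    ; idle = (zero , zero) , inj₁ refl ; idle-δ = λ a → pairAct-just z≤n (+-identityʳ (toℕ a))
    ; move = λ a c → pureMove a c , pureMove-pure a c ; move-δ = pairAct-pureMove
    ; move-on-off-disabled = refl }

  -- The zero pair is not an event of the ℤ-types, so staying put uses the integer 0.
  joinable-ZPT : Joinable (τZPT (suc k))
  joinable-ZPT = record
    { off = zero ; on = suc zero ; on≢off = λ ()
    ; idle = inj₂ zero ; idle-δ = modAct-zero
    ; move = λ a c → proj₁ (zMove a c) ; move-δ = λ a c → proj₂ (zMove a c)
    ; move-on-off-disabled = refl }
    where
    zMove : ∀ a c → Σ (Ev (τZPT (suc k))) λ ev → δτ (τZPT (suc k)) a ev ≡ just c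
    zMove a c with a ≟ c
    ... | yes refl = inj₂ zero , modAct-zero a
    ... | no  a≢c  = inj₁ (pureMove a c , pureMove-nonzero a≢c) , pairAct-pureMove a c

  joinable-ZPPT : Joinable (τZPPT (suc k))
  joinable-ZPPT = record
    { off = zero ; on = suc zero ; on≢off = λ ()
    ; idle = inj₂ zero ; idle-δ = modAct-zero
    ; move = λ a c → proj₁ (zMove a c) ; move-δ = λ a c → proj₂ (zMove a c)
    ; move-on-off-disabled = refl }
    where
    zMove : ∀ a c → Σ (Ev (τZPPT (suc k))) λ ev → δτ (τZPPT (suc k)) a ev ≡ just c
    zMove a c with a ≟ c
    ... | yes refl = inj₂ zero , modAct-zero a
    ... | no  a≢c  = inj₁ (pureMove a c , pureMove-pure a c , pureMove-nonzero a≢c)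
                     , pairAct-pureMove a c

module _ (b : ℕ) where
  open PairActions b

  separates-PPT : SeparatesStates (τPPT b)
  separates-PPT a≢v with separatingPair a≢v
  ... | p , pure , c , enabled , disabled = (p , pure) , c , enabled , disabled

  separates-PT : SeparatesStates (τPT b)
  separates-PT a≢v with separatingPair a≢v
  ... | p , _ , c , enabled , disabled = p , c , enabled , disabled

ESSASolvable : (τ : Ty) {S E : Set} (δ : S → E → Maybe S) → E → S → Set
ESSASolvable τ δ e s = Σ (Region τ δ) λ R → δτ τ (sup R s) (sig R e) ≡ nothing

essp-distinguishes : ∀ {τ S E} {δ : S → E → Maybe S} → ESSP τ δ →
  ∀ {u v e v'} → δ u e ≡ nothing → δ v e ≡ just v' → Σ (Region τ δ) λ R → sup R u ≢ sup R v
essp-distinguishes {τ} essp {u} {v} {e} {v'} u-dis v-en with essp e u u-dis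
... | R , solved = R , λ u≡v → contradiction
  (trans (sym solved) (subst (λ a → δτ τ a (sig R e) ≡ just (sup R v')) (sym u≡v) (hom R v e v' v-en)))
  λ ()

block : ∀ {m n} (A : Fin (suc n) → TS m) {Q : Set} → USt A ⊎ Q → Fin (suc n) ⊎ Q
block A (inj₁ (i , _)) = inj₁ i
block A (inj₂ q)       = inj₂ q

-- J(U) and LJ(U) both have this shape: old events never occur at fresh states, and each
-- fresh event labels exactly one edge, which leaves its block.
record Extension {m n} (A : Fin (suc n) → TS m) (Q X : Set) : Set where
  field
    δ⁺           : USt A ⊎ Q → Fin m ⊎ X → Maybe (USt A ⊎ Q)
    δ⁺-old       : ∀ u e → δ⁺ (inj₁ u) (inj₁ e) ≡ Maybe.map inj₁ (Uδ A u e)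
    δ⁺-new       : ∀ q e → δ⁺ (inj₂ q) (inj₁ e) ≡ nothing
    src tgt      : X → USt A ⊎ Q
    src-enabled  : ∀ x → δ⁺ (src x) (inj₂ x) ≡ just (tgt x)
    fresh-edge   : ∀ {p x p'} → δ⁺ p (inj₂ x) ≡ just p' → p ≡ src x × p' ≡ tgt x
    fresh-crosses : ∀ x → block A (src x) ≢ block A (tgt x)
    _≟Q_         : DecidableEquality Q

module Extensions {τ : Ty} (K : Joinable τ) {m n} {A : Fin (suc n) → TS m} {Q X : Set}
                  (E : Extension A Q X) where
  open Joinable K
  open Extension E

  moves : (USt A ⊎ Q → St τ) → X → Ev τ
  moves sup⁺ x = move (sup⁺ (src x)) (sup⁺ (tgt x))

  region : (sup⁺ : USt A ⊎ Q → St τ) (sigU : Fin m → Ev τ) →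
    (∀ i s e s' → δ (A i) s e ≡ just s' →
       δτ τ (sup⁺ (inj₁ (i , s))) (sigU e) ≡ just (sup⁺ (inj₁ (i , s')))) →
    (sigX : X → Ev τ) → (∀ x → δτ τ (sup⁺ (src x)) (sigX x) ≡ just (sup⁺ (tgt x))) →
    Region τ δ⁺
  region sup⁺ sigU homU sigX homX = record { sup = sup⁺ ; sig = [ sigU , sigX ] ; hom = hom⁺ }
    where
    hom⁺ : ∀ p e p' → δ⁺ p e ≡ just p' → δτ τ (sup⁺ p) ([ sigU , sigX ] e) ≡ just (sup⁺ p')
    hom⁺ (inj₁ (i , s)) (inj₁ e) p' eq with δ (A i) s e in h | trans (sym (δ⁺-old (i , s) e)) eq
    ... | just s' | refl = homU i s e s' h
    ... | nothing | ()
    hom⁺ (inj₂ q) (inj₁ e) p' eq with trans (sym (δ⁺-new q e)) eq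
    ... | ()
    hom⁺ p (inj₂ x) p' eq with fresh-edge eq
    ... | refl , refl = homX x

  extendWith : (R : Region τ (Uδ A)) (f : Q → St τ) (sigX : X → Ev τ) →
    (∀ x → δτ τ ([ sup R , f ] (src x)) (sigX x) ≡ just ([ sup R , f ] (tgt x))) →
    Region τ δ⁺
  extendWith R f = region [ sup R , f ] (sig R) (λ i s e s' h → hom R _ e _ (cong (Maybe.map (i ,_)) h))

  extend : Region τ (Uδ A) → (Q → St τ) → Region τ δ⁺
  extend R f = extendWith R f (moves [ sup R , f ]) (λ x → move-δ _ _)

  blockRegion : (Fin (suc n) ⊎ Q → St τ) → Region τ δ⁺
  blockRegion g = region (g ∘ block A) (λ _ → idle) (λ i s e s' _ → idle-δ (g (inj₁ i)))
                         (moves (g ∘ block A)) (λ x → move-δ _ _)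

  restrict : Region τ δ⁺ → Region τ (Uδ A)
  restrict R = record
    { sup = sup R ∘ inj₁ ; sig = sig R ∘ inj₁
    ; hom = λ u e u' eq → hom R (inj₁ u) (inj₁ e) (inj₁ u') (trans (δ⁺-old u e) (cong (Maybe.map inj₁) eq)) }

  _≟B_ : DecidableEquality (Fin (suc n) ⊎ Q)
  _≟B_ = ≡-dec _≟_ _≟Q_

  indicator : Fin (suc n) ⊎ Q → Fin (suc n) ⊎ Q → St τ
  indicator β γ with γ ≟B β
  ... | yes _ = on
  ... | no  _ = off

  indicator-self : ∀ β → indicator β β ≡ on
  indicator-self β with β ≟B β
  ... | yes _   = refl
  ... | no  β≢β = contradiction refl β≢β

  indicator-other : ∀ {β γ} → γ ≢ β → indicator β γ ≡ off
  indicator-other {β} {γ} γ≢β with γ ≟B β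
  ... | yes γ≡β = contradiction γ≡β γ≢β
  ... | no  _   = refl

  separate-blocks : ∀ {p p'} → block A p ≢ block A p' → Σ (Region τ δ⁺) λ R → sup R p ≢ sup R p'
  separate-blocks {p} ne = blockRegion (indicator (block A p)) ,
    λ eq → on≢off (trans (sym (indicator-self (block A p))) (trans eq (indicator-other (ne ∘ sym))))

  solve-outside-source-block : ∀ {x p} → block A p ≢ block A (src x) → ESSASolvable τ δ⁺ (inj₂ x) p
  solve-outside-source-block {x} {p} ne = blockRegion (indicator β) , disabled
    where
    β = block A (src x)
    disabled : δτ τ (indicator β (block A p)) (move (indicator β β) (indicator β (block A (tgt x)))) ≡ nothing
    disabled rewrite indicator-self β | indicator-other ne | indicator-other (fresh-crosses x ∘ sym) =
      move-on-off-disabled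

  disabled-off-source : ∀ {x p} → δ⁺ p (inj₂ x) ≡ nothing → p ≢ src x
  disabled-off-source {x} dis refl with trans (sym (src-enabled x)) dis
  ... | ()

  block-inj₂ : ∀ {p : USt A ⊎ Q} {q} → block A p ≡ inj₂ q → p ≡ inj₂ q
  block-inj₂ {inj₁ _} ()
  block-inj₂ {inj₂ _} refl = refl

  solve-at-fresh-source : ∀ {x p q} → src x ≡ inj₂ q → δ⁺ p (inj₂ x) ≡ nothing →
                          ESSASolvable τ δ⁺ (inj₂ x) p
  solve-at-fresh-source {x} {p} src≡q dis with block A p ≟B block A (src x)
  ... | no  ne   = solve-outside-source-block ne
  ... | yes same = contradiction
    (trans (block-inj₂ (trans same (cong (block A) src≡q))) (sym src≡q)) (disabled-off-source dis)

  FreshESSP : Set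
  FreshESSP = ∀ x p → δ⁺ p (inj₂ x) ≡ nothing → ESSASolvable τ δ⁺ (inj₂ x) p

  essp-extend : UESSP τ A → EveryEventDisabled A → FreshESSP → ESSP τ δ⁺
  essp-extend U D fresh (inj₁ e) (inj₁ u) dis
    with U e u (map-injective inj₁-injective (trans (sym (δ⁺-old u e)) dis))
  ... | R , solved = extend R (λ _ → off) , solved
  essp-extend U D fresh (inj₁ e) (inj₂ q) _ with D e
  ... | u , u-dis with U e u u-dis
  ...   | R , solved = extend R (λ _ → sup R u) , solved
  essp-extend U D fresh (inj₂ x) p dis = fresh x p dis

  ssp-extend : USSP τ A → SSP τ δ⁺
  ssp-extend U (inj₁ (i , s)) (inj₁ (i' , s')) ne with i ≟ i'
  ... | yes refl = let R , separated = U i s s' (ne ∘ cong (λ s → inj₁ (i , s))) in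
                   extend R (λ _ → off) , separated
  ... | no  i≢i' = separate-blocks (i≢i' ∘ inj₁-injective)
  ssp-extend U (inj₁ _) (inj₂ _) _  = separate-blocks λ ()
  ssp-extend U (inj₂ _) (inj₁ _) _  = separate-blocks λ ()
  ssp-extend U (inj₂ _) (inj₂ _) ne = separate-blocks (ne ∘ cong inj₂ ∘ inj₂-injective)

  essp-restrict : ESSP τ δ⁺ → UESSP τ A
  essp-restrict E e u dis with E (inj₁ e) (inj₁ u) (trans (δ⁺-old u e) (cong (Maybe.map inj₁) dis))
  ... | R , solved = restrict R , solved

  ssp-restrict : SSP τ δ⁺ → USSP τ A
  ssp-restrict S i s s' ne with S (inj₁ (i , s)) (inj₁ (i , s')) (λ { refl → ne refl })
  ... | R , separated = restrict R , separated

  ssp-⇔ : USSP τ A ⇔ SSP τ δ⁺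
  ssp-⇔ = mk⇔ ssp-extend ssp-restrict

  essp-⇔ : EveryEventDisabled A → (UESSP τ A → FreshESSP) → UESSP τ A ⇔ ESSP τ δ⁺
  essp-⇔ D fresh = mk⇔ (λ U → essp-extend U D (fresh U)) essp-restrict

inject₁≢suc : ∀ {n} (j : Fin n) → inject₁ j ≢ suc j
inject₁≢suc j eq = 1+n≢n (trans (sym (cong toℕ eq)) (toℕ-inject₁ j))

module _ {m n} (A : Fin (suc n) → TS m) where

  joinSrc joinTgt : Fin n ⊎ Fin (suc n) → JSt A
  joinSrc (inj₁ j) = inj₂ (inject₁ j)
  joinSrc (inj₂ i) = inj₂ i
  joinTgt (inj₁ j) = inj₂ (suc j)
  joinTgt (inj₂ i) = inj₁ (i , ι (A i))

  Jδ-fresh : ∀ {p x p'} → Jδ A p (inj₂ x) ≡ just p' → p ≡ joinSrc x × p' ≡ joinTgt x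
  Jδ-fresh {inj₁ _} ()
  Jδ-fresh {inj₂ i} {inj₁ j} eq with i ≟ inject₁ j
  Jδ-fresh {inj₂ i} {inj₁ j} refl | yes refl = refl , refl
  Jδ-fresh {inj₂ i} {inj₁ j} ()   | no _
  Jδ-fresh {inj₂ i} {inj₂ k} eq with i ≟ k
  Jδ-fresh {inj₂ i} {inj₂ k} refl | yes refl = refl , refl
  Jδ-fresh {inj₂ i} {inj₂ k} ()   | no _

  Jδ-src : ∀ x → Jδ A (joinSrc x) (inj₂ x) ≡ just (joinTgt x)
  Jδ-src (inj₁ j) rewrite ≡-≟-identity _≟_ {inject₁ j} refl = refl
  Jδ-src (inj₂ i) rewrite ≡-≟-identity _≟_ {i} refl = refl

  joinCrosses : ∀ x → block A (joinSrc x) ≢ block A (joinTgt x)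
  joinCrosses (inj₁ j) = inject₁≢suc j ∘ inj₂-injective
  joinCrosses (inj₂ i) ()

  joining : Extension A (Fin (suc n)) (Fin n ⊎ Fin (suc n))
  joining = record
    { δ⁺ = Jδ A ; δ⁺-old = λ _ _ → refl ; δ⁺-new = λ _ _ → refl
    ; src = joinSrc ; tgt = joinTgt ; src-enabled = Jδ-src ; fresh-edge = Jδ-fresh
    ; fresh-crosses = joinCrosses ; _≟Q_ = _≟_ }

joining-⇔ : ∀ {τ} → Joinable τ → ∀ {m n} (A : Fin (suc n) → TS m) → EveryEventDisabled A →
  (UESSP τ A ⇔ ESSP τ (Jδ A)) × (USSP τ A ⇔ SSP τ (Jδ A))
joining-⇔ K A D = essp-⇔ D (λ _ → fresh) , ssp-⇔
  where
  open Extensions K (joining A)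
  fresh : FreshESSP
  fresh (inj₁ j) p = solve-at-fresh-source refl
  fresh (inj₂ i) p = solve-at-fresh-source refl

module _ {m n} (A : Fin (suc n) → TS m) (t : (i : Fin (suc n)) → Fin (size (A i))) where

  linJoinSrc linJoinTgt : Fin n ⊎ Fin n → LJSt A
  linJoinSrc (inj₁ j) = inj₁ (inject₁ j , t (inject₁ j))
  linJoinSrc (inj₂ j) = inj₂ j
  linJoinTgt (inj₁ j) = inj₂ j
  linJoinTgt (inj₂ j) = inj₁ (suc j , ι (A (suc j)))

  LJδ-fresh : ∀ {p x p'} → LJδ A t p (inj₂ x) ≡ just p' → p ≡ linJoinSrc x × p' ≡ linJoinTgt x
  LJδ-fresh {inj₁ (i , s)} {inj₁ j} eq with i ≟ inject₁ j | s ≟ t i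
  LJδ-fresh {inj₁ (i , s)} {inj₁ j} refl | yes refl | yes refl = refl , refl
  LJδ-fresh {inj₁ (i , s)} {inj₁ j} ()   | yes _    | no _
  LJδ-fresh {inj₁ (i , s)} {inj₁ j} ()   | no _     | _
  LJδ-fresh {inj₁ _} {inj₂ _} ()
  LJδ-fresh {inj₂ _} {inj₁ _} ()
  LJδ-fresh {inj₂ j} {inj₂ k} eq with j ≟ k
  LJδ-fresh {inj₂ j} {inj₂ k} refl | yes refl = refl , refl
  LJδ-fresh {inj₂ j} {inj₂ k} ()   | no _

  LJδ-src : ∀ x → LJδ A t (linJoinSrc x) (inj₂ x) ≡ just (linJoinTgt x)
  LJδ-src (inj₁ j)
    rewrite ≡-≟-identity _≟_ {inject₁ j} refl | ≡-≟-identity _≟_ {t (inject₁ j)} refl = refl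
  LJδ-src (inj₂ j) rewrite ≡-≟-identity _≟_ {j} refl = refl

  linJoinCrosses : ∀ x → block A (linJoinSrc x) ≢ block A (linJoinTgt x)
  linJoinCrosses (inj₁ j) ()
  linJoinCrosses (inj₂ j) ()

  linearJoining : Extension A (Fin n) (Fin n ⊎ Fin n)
  linearJoining = record
    { δ⁺ = LJδ A t ; δ⁺-old = λ _ _ → refl ; δ⁺-new = λ _ _ → refl
    ; src = linJoinSrc ; tgt = linJoinTgt ; src-enabled = LJδ-src ; fresh-edge = LJδ-fresh
    ; fresh-crosses = linJoinCrosses ; _≟Q_ = _≟_ }

module _ {τ} (K : Joinable τ) (separates : SeparatesStates τ)
         {m n} (A : Fin (suc n) → TS m) (t : (i : Fin (suc n)) → Fin (size (A i)))
         (t-dead : ∀ i e → δ (A i) (t i) e ≡ nothing)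
         (others-live : ∀ i s → s ≢ t i → Σ (Fin m) λ e → Σ (Fin (size (A i))) λ s' → δ (A i) s e ≡ just s')
         where
  open Joinable K
  open Extensions K (linearJoining A t)

  solve-in-source-component : UESSP τ A → ∀ j s → s ≢ t (inject₁ j) →
    ESSASolvable τ (LJδ A t) (inj₂ (inj₁ j)) (inj₁ (inject₁ j , s))
  solve-in-source-component U j s s≢t
    with others-live (inject₁ j) s s≢t
  ... | e , _ , s-enabled
    with essp-distinguishes U (cong (Maybe.map _) (t-dead (inject₁ j) e)) (cong (Maybe.map _) s-enabled)
  ... | R , t≢s
    with separates t≢s
  ... | ev , c , ev-enabled , ev-disabled = extendWith R (λ _ → c) sigW homW , sigW-j-disabled
    where
    sup⁺ = [ sup R , (λ _ → c) ]
    sigW : Fin n ⊎ Fin n → Ev τ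
    sigW (inj₁ j') with j' ≟ j
    ... | yes _ = ev
    ... | no  _ = moves sup⁺ (inj₁ j')
    sigW (inj₂ j') = moves sup⁺ (inj₂ j')
    homW : ∀ x → δτ τ (sup⁺ (linJoinSrc A t x)) (sigW x) ≡ just (sup⁺ (linJoinTgt A t x))
    homW (inj₁ j') with j' ≟ j
    ... | yes refl = ev-enabled
    ... | no  _    = move-δ _ _
    homW (inj₂ j') = move-δ _ _
    sigW-j-disabled : δτ τ (sup R (inject₁ j , s)) (sigW (inj₁ j)) ≡ nothing
    sigW-j-disabled rewrite ≡-≟-identity _≟_ {j} refl = ev-disabled

  fresh-essp : UESSP τ A → FreshESSP
  fresh-essp U (inj₂ j) p = solve-at-fresh-source refl
  fresh-essp U (inj₁ j) (inj₂ q) _ = solve-outside-source-block λ ()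
  fresh-essp U (inj₁ j) (inj₁ (i , s)) dis with disabled-off-source {inj₁ j} {inj₁ (i , s)} dis | i ≟ inject₁ j
  ... | ≢src | yes refl = solve-in-source-component U j s (≢src ∘ cong (λ s → inj₁ (i , s)))
  ... | _    | no  i≢j  = solve-outside-source-block (i≢j ∘ inj₁-injective)

  linearJoining-⇔ : EveryEventDisabled A →
    (UESSP τ A ⇔ ESSP τ (LJδ A t)) × (USSP τ A ⇔ SSP τ (LJδ A t))
  linearJoining-⇔ D = essp-⇔ D fresh-essp , ssp-⇔

linδ-terminal : ∀ {m l} (w : Vec (Fin m) l) e → linδ w (fromℕ l) e ≡ nothing
linδ-terminal []      e = refl
linδ-terminal (x ∷ w) e rewrite linδ-terminal w e = refl

linδ-live : ∀ {m l} (w : Vec (Fin m) l) s → s ≢ fromℕ l →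
  Σ (Fin m) λ e → Σ (Fin (suc l)) λ s' → linδ w s e ≡ just s'
linδ-live []      zero    s≢t = contradiction refl s≢t
linδ-live (x ∷ w) zero    _   = x , suc zero , first-step
  where
  first-step : linδ (x ∷ w) zero x ≡ just (suc zero)
  first-step rewrite ≡-≟-identity _≟_ {x} refl = refl
linδ-live (x ∷ w) (suc s) s≢t with linδ-live w s (s≢t ∘ cong suc)
... | e , s' , enabled = e , suc s' , cong (Maybe.map suc) enabled

linearUnion-⇔ : ∀ {τ} → Joinable τ → SeparatesStates τ →
  ∀ {m n} {len : Fin (suc n) → ℕ} (w : (i : Fin (suc n)) → Vec (Fin m) (len i)) →
  EveryEventDisabled (λ i → linTS (w i)) →
  (UESSP τ (λ i → linTS (w i)) ⇔ ESSP τ (LJδ (λ i → linTS (w i)) (λ i → terminal (len i))))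
  × (USSP τ (λ i → linTS (w i)) ⇔ SSP τ (LJδ (λ i → linTS (w i)) (λ i → terminal (len i))))
linearUnion-⇔ K separates w =
  linearJoining-⇔ K separates (λ i → linTS (w i)) (λ i → terminal _)
    (λ i → linδ-terminal (w i)) (λ i → linδ-live (w i))

-- Only b ≥ 1 is used in the ℤ-case.
lemma4 :
    (∀ (b : ℕ) → 1 ≤ b → (τ : Ty) → (τ ≡ τPT b ⊎ τ ≡ τPPT b) →
      ∀ (m n : ℕ) (len : Fin (suc n) → ℕ) (w : (i : Fin (suc n)) → Vec (Fin m) (len i)) →
      EveryEventDisabled (λ i → linTS (w i)) →
      (UESSP τ (λ i → linTS (w i)) ⇔ ESSP τ (LJδ (λ i → linTS (w i)) (λ i → terminal (len i))))
      × (USSP τ (λ i → linTS (w i)) ⇔ SSP τ (LJδ (λ i → linTS (w i)) (λ i → terminal (len i)))))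
    ×
    (∀ (b : ℕ) → 2 ≤ b → (τ : Ty) → (τ ≡ τZPT b ⊎ τ ≡ τZPPT b) →
      ∀ (m n : ℕ) (A : Fin (suc n) → TS m) →
      EveryEventDisabled A →
      (UESSP τ A ⇔ ESSP τ (Jδ A)) × (USSP τ A ⇔ SSP τ (Jδ A)))
lemma4 =
    (λ { zero ()
       ; (suc k) _ _ (inj₁ refl) _ _ _ w → linearUnion-⇔ (joinable-PT k) (separates-PT (suc k)) w
       ; (suc k) _ _ (inj₂ refl) _ _ _ w → linearUnion-⇔ (joinable-PPT k) (separates-PPT (suc k)) w })
  , (λ { zero ()
       ; (suc k) _ _ (inj₁ refl) _ _ A → joining-⇔ (joinable-ZPT k) A
       ; (suc k) _ _ (inj₂ refl) _ _ A → joining-⇔ (joinable-ZPPT k) A })
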